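{- If $(\mathbb S,+,\Box,\partial)$ is an arithmetical semiring that satisfies axioms $\mathcal G_1^+$ and $\mathcal G_2^+$, then it also satisfies axioms $\mathcal G_1^\Box$, $\mathcal G_2^\Box$ and $\mathcal G_3^\Box$.
   Context: An arithmetical semiring is a tuple $(\mathbb S,+,\Box,\partial)$ where: $(\mathbb S,+)$ is a commutative monoid with identity $\mathbf e_+$ which is free on a set $\mathbb S^+\subseteq\mathbb S\setminus\{\mathbf e_+\}$ (additive primes); $\Box$ is a commutative associative operation distributive over $+$ making $\mathbb S\setminus\{\mathbf e_+\}$ a commutative monoid with identity $\mathbf e_\Box$; $\partial:\mathbb S\to\mathbb R_{\ge0}$ satisfies $\partial(A+B)=\partial(A)+\partial(B)$ and $\partial(A\Box B)=\partial(A)\partial(B)$; $\partial^{ -1}(0)=\{\mathbf e_+\}$; each $\partial^{ -1}(x)$ is finite and is empty unless $x$ is an integer; $(\mathbb S^+,\Box)$ is a free commutative monoid with identity $\mathbf e_\Box$ on a set $\mathbb S^\Box\subseteq\mathbb S^+\setminus\{\mathbf e_\Box\}$ (multiplicative primes); and $\mathbf e_\Box$ is the only additive prime of degree $1$. $\mathbb S(n)$, $\mathbb S^+(n)$, $\mathbb S^\Box(n)$ denote the numbers of elements of $\mathbb S$, $\mathbb S^+$, $\mathbb S^\Box$ of degree $n$. For nonnegative sequences: $a_n=O(b_n)$ means $a_n\le Cb_n$ for a constant $C$ and large $n$; $a_n=o(b_n)$ means for every $\epsilon>0$, $a_n\le\epsilon b_n$ for large $n$; $a_n\sim b_n$ means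 $a_n-b_n=o(a_n)$. Axioms: $\mathcal G_1^+$: $\mathbb S(n)\sim\mathbb S^+(n)$; $\mathcal G_2^+$: $\mathbb S^+(n-1)=o(\mathbb S^+(n))$; $\mathcal G_1^\Box$: $\mathbb S^+(n)\sim\mathbb S^\Box(n)$; $\mathcal G_2^\Box$: $\mathbb S^\Box(\lfloor n/2\rfloor)=o(\mathbb S^\Box(n))$; $\mathcal G_3^\Box$: $\mathcal G_2^\Box$ holds and $\mathbb S^+(n)-\mathbb S^\Box(n)=O(\mathbb S^\Box(\lfloor n/2\rfloor))$. -}

module Defs where

open import Data.Unit using (⊤)
open import Data.Nat using (ℕ; zero; suc; _+_; _*_; _∸_; _≤_; _≥_; ∣_-_∣; ⌊_/2⌋)
open import Data.List using (List; []; _∷_; foldr; length)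
open import Data.List.Membership.Propositional using (_∈_)
open import Data.List.Relation.Unary.All using (All)
open import Data.List.Relation.Unary.Unique.Propositional using (Unique)
open import Data.List.Relation.Binary.Permutation.Propositional using (_↭_)
open import Data.Product using (Σ; ∃; ∃-syntax; _×_)
open import Relation.Nullary using (¬_)
open import Relation.Binary.PropositionalEquality using (_≡_)

BigO : (ℕ → ℕ) → (ℕ → ℕ) → Set
BigO a b = ∃[ C ] ∃[ N ] (∀ n → n ≥ N → a n ≤ C * b n)

-- a_n = o(b_n): for every ε > 0, a_n ≤ ε b_n for large n.
-- ε ranges over the positive rationals p/q (p = suc p', q = suc q');
-- a_n ≤ (p/q) b_n  ⇔  q a_n ≤ p b_n.  (Density of ℚ makes this the
-- same as quantifying over real ε > 0.)
LittleO : (ℕ → ℕ) → (ℕ → ℕ) → Set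
LittleO a b = ∀ p′ q′ → ∃[ N ] (∀ n → n ≥ N → suc q′ * a n ≤ suc p′ * b n)

Asym : (ℕ → ℕ) → (ℕ → ℕ) → Set
Asym a b = LittleO (λ n → ∣ a n - b n ∣) a

-- Free commutative monoids, phrased as unique factorisation:
-- every element is a finite combination of generators, unique up to
-- reordering.

IsFreeOn : {M : Set} → (M → M → M) → M → (M → Set) → (M → Set) → Set
IsFreeOn {M} _∙_ ε Dom Gen =
  (∀ x → Dom x → ∃[ xs ] (All Gen xs × foldr _∙_ ε xs ≡ x))
  × (∀ xs ys → All Gen xs → All Gen ys →
       foldr _∙_ ε xs ≡ foldr _∙_ ε ys → xs ↭ ys)

record Enumerates {M : Set} (P : M → Set) (xs : List M) : Set where
  field
    unique   : Unique xs
    sound    : All P xs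
    complete : ∀ x → P x → x ∈ xs

record ArithmeticalSemiring : Set₁ where
  infixl 6 _⊕_
  infixl 7 _□_
  field
    S    : Set
    _⊕_  : S → S → S
    _□_  : S → S → S
    e₊   : S
    e□   : S
    ∂    : S → ℕ          -- ℝ≥0-valued in the paper, but fibres are empty off ℕ
    AddPrime : S → Set
    MulPrime : S → Set

    ⊕-assoc    : ∀ a b c → (a ⊕ b) ⊕ c ≡ a ⊕ (b ⊕ c)
    ⊕-comm     : ∀ a b → a ⊕ b ≡ b ⊕ a
    ⊕-identity : ∀ a → e₊ ⊕ a ≡ a
    addPrime-ne : ∀ a → AddPrime a → ¬ (a ≡ e₊)
    ⊕-free      : IsFreeOn _⊕_ e₊ (λ _ → ⊤) AddPrime

    □-assoc   : ∀ a b c → (a □ b) □ c ≡ a □ (b □ c)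
    □-comm    : ∀ a b → a □ b ≡ b □ a
    □-distrib : ∀ a b c → a □ (b ⊕ c) ≡ (a □ b) ⊕ (a □ c)
    e□-ne      : ¬ (e□ ≡ e₊)
    □-closed   : ∀ a b → ¬ (a ≡ e₊) → ¬ (b ≡ e₊) → ¬ (a □ b ≡ e₊)
    □-identity : ∀ a → ¬ (a ≡ e₊) → e□ □ a ≡ a

    ∂-⊕     : ∀ a b → ∂ (a ⊕ b) ≡ ∂ a + ∂ b
    ∂-□     : ∀ a b → ∂ (a □ b) ≡ ∂ a * ∂ b
    ∂-zero  : ∀ a → ∂ a ≡ 0 → a ≡ e₊
    ∂-e₊    : ∂ e₊ ≡ 0
    -- each fibre ∂⁻¹(n) is finite (enumerations of the fibres and of
    -- their intersections with 𝕊⁺ and 𝕊^□)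
    fibre        : ℕ → List S
    fibre-enum   : ∀ n → Enumerates (λ a → ∂ a ≡ n) (fibre n)
    fibre⁺       : ℕ → List S
    fibre⁺-enum  : ∀ n → Enumerates (λ a → AddPrime a × ∂ a ≡ n) (fibre⁺ n)
    fibre□       : ℕ → List S
    fibre□-enum  : ∀ n → Enumerates (λ a → MulPrime a × ∂ a ≡ n) (fibre□ n)

    e□-addPrime   : AddPrime e□
    addPrime-□    : ∀ a b → AddPrime a → AddPrime b → AddPrime (a □ b)
    mulPrime-add  : ∀ a → MulPrime a → AddPrime a
    mulPrime-ne   : ∀ a → MulPrime a → ¬ (a ≡ e□)
    □-free        : IsFreeOn _□_ e□ AddPrime MulPrime

    deg1 : ∀ a → AddPrime a → ∂ a ≡ 1 → a ≡ e□

module Counting (𝕊 : ArithmeticalSemiring) where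
  open ArithmeticalSemiring 𝕊

  Sₙ S⁺ₙ S□ₙ : ℕ → ℕ
  Sₙ  n = length (fibre n)
  S⁺ₙ n = length (fibre⁺ n)
  S□ₙ n = length (fibre□ n)

  G₁⁺ : Set
  G₁⁺ = Asym Sₙ S⁺ₙ

  G₂⁺ : Set
  G₂⁺ = LittleO (λ n → S⁺ₙ (n ∸ 1)) S⁺ₙ

  G₁□ : Set
  G₁□ = Asym S⁺ₙ S□ₙ

  G₂□ : Set
  G₂□ = LittleO (λ n → S□ₙ ⌊ n /2⌋) S□ₙ

  G₃□ : Set
  G₃□ = G₂□ × BigO (λ n → ∣ S⁺ₙ n - S□ₙ n ∣) (λ n → S□ₙ ⌊ n /2⌋)

-- An additive prime a of degree n that is not a multiplicative prime factors
-- as a = r □ b with r, b additive primes, where either ∂ r = 2 (so b is one of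
-- the 𝕊⁺(n/2) additive primes of degree n/2), or ∂ r, ∂ b ≥ 3.  In the second
-- case a is the □-product of the additive prime summands of r + b, an element
-- of degree ∂ r + ∂ b < n/2 once n ≥ 24.  Hence for such n
--   𝕊⁺(n) − 𝕊^□(n) ≤ 𝕊⁺(2) 𝕊⁺(n/2) + Σ_{m < n/2} 𝕊(m).
-- By 𝒢₁⁺, 𝕊(m) ≤ 2 𝕊⁺(m) eventually, and by 𝒢₂⁺, 𝕊⁺ eventually at least
-- doubles at each step, so the sum is O(𝕊⁺(n/2)); 𝒢₂⁺ also gives
-- 𝕊⁺(n/2) = o(𝕊⁺(n)).  This yields 𝒢₁^□, then 𝕊⁺ ≤ 2 𝕊^□ eventually,
-- and from that 𝒢₂^□ and 𝒢₃^□.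
module Submission where

open import Defs
open import Data.Fin using (Fin; zero; suc)
open import Data.Fin.Properties using (injective⇒≤)
open import Data.List using (List; []; _∷_; _++_; length; lookup; map; foldr; cartesianProductWith)
open import Data.List.Properties using (length-++; length-map)
open import Data.List.Membership.Propositional using (_∈_)
open import Data.List.Membership.Propositional.Properties
  using (∈-lookup; ∈-map⁺; ∈-++⁺ˡ; ∈-++⁺ʳ; ∈-length; ∈-cartesianProductWith⁺)
import Data.List.Membership.Setoid.Properties as Membershipₛ
open import Data.List.Relation.Binary.Subset.Propositional using (_⊆_)
open import Data.List.Relation.Binary.Permutation.Propositional using (_↭_; refl; prep; swap; trans)
open import Data.List.Relation.Unary.All as All using (All; []; _∷_)
open import Data.List.Relation.Unary.AllPairs using (_∷_)
open import Data.List.Relation.Unary.Any using (index)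
open import Data.List.Relation.Unary.Unique.Propositional using (Unique)
open import Data.Nat
  using (ℕ; zero; suc; _+_; _*_; _∸_; _≤_; _<_; _≥_; _≤′_; ≤′-refl; ≤′-step; z≤n; s≤s; s≤s⁻¹; _≟_; ⌊_/2⌋; ∣_-_∣; _⊔_)
open import Data.Nat.Properties
open import Data.Nat.Tactic.RingSolver using (solve-∀)
open import Data.Product using (∃-syntax; ∃₂; _×_; _,_; proj₁; proj₂)
open import Data.Sum using (_⊎_; inj₁; inj₂)
open import Data.Unit using (tt)
open import Function using (_∘_)
open import Relation.Nullary using (yes; no; contradiction)
open import Relation.Binary.PropositionalEquality
  using (_≡_; refl; sym; cong; cong₂; subst; subst₂; ≢-sym; module ≡-Reasoning; setoid)
  renaming (trans to ≡-trans)

module _ {A : Set} where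

  lookup-injective : ∀ {xs : List A} → Unique xs → ∀ i j → lookup xs i ≡ lookup xs j → i ≡ j
  lookup-injective (_ ∷ _)     zero    zero    _  = refl
  lookup-injective (x∉xs ∷ _) zero    (suc j) eq = contradiction eq (All.lookup x∉xs (∈-lookup j))
  lookup-injective (x∉xs ∷ _) (suc i) zero    eq = contradiction (sym eq) (All.lookup x∉xs (∈-lookup i))
  lookup-injective (_ ∷ u)     (suc i) (suc j) eq = cong suc (lookup-injective u i j eq)

  Unique-⊆⇒length≤ : ∀ {xs ys : List A} → Unique xs → xs ⊆ ys → length xs ≤ length ys
  Unique-⊆⇒length≤ {xs} {ys} u xs⊆ys = injective⇒≤ {f = position} λ {i} {j} eq →
    lookup-injective u i j (Membershipₛ.index-injective (setoid A) (xs⊆ys (∈-lookup i)) (xs⊆ys (∈-lookup j)) eq)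
    where
      position : Fin (length xs) → Fin (length ys)
      position i = index (xs⊆ys (∈-lookup i))

length-cartesianProductWith : ∀ {A B C : Set} (f : A → B → C) xs ys →
  length (cartesianProductWith f xs ys) ≡ length xs * length ys
length-cartesianProductWith f []       ys = refl
length-cartesianProductWith f (x ∷ xs) ys = begin
  length (map (f x) ys ++ cartesianProductWith f xs ys)          ≡⟨ length-++ (map (f x) ys) ⟩
  length (map (f x) ys) + length (cartesianProductWith f xs ys)  ≡⟨ cong₂ _+_ (length-map (f x) ys)
                                                                      (length-cartesianProductWith f xs ys) ⟩
  length ys + length xs * length ys                              ∎
  where open ≡-Reasoning

⌊2*n/2⌋≡n : ∀ n → ⌊ 2 * n /2⌋ ≡ n
⌊2*n/2⌋≡n n = ≡-trans (cong (λ m → ⌊ n + m /2⌋) (+-identityʳ n)) (sym (n≡⌊n+n/2⌋ n))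

2*m≤n⇒m≤⌊n/2⌋ : ∀ {m n} → 2 * m ≤ n → m ≤ ⌊ n /2⌋
2*m≤n⇒m≤⌊n/2⌋ {m} 2m≤n = subst (_≤ _) (⌊2*n/2⌋≡n m) (⌊n/2⌋-mono 2m≤n)

-- (m − 3)(n − 3) ≥ 0 gives 3 (m + n) ≤ m n + 9, and m n ≥ 24 absorbs the constant.
2*[1+m+n]≤m*n : ∀ {m n} → 3 ≤ m → 3 ≤ n → 24 ≤ m * n → 2 * suc (m + n) ≤ m * n
2*[1+m+n]≤m*n {m@(suc (suc (suc x)))} {n@(suc (suc (suc y)))} (s≤s (s≤s (s≤s _))) (s≤s (s≤s (s≤s _))) 24≤mn =
  *-cancelˡ-≤ 3 (begin
  3 * (2 * suc (m + n))                ≤⟨ m≤m+n _ (2 * (x * y)) ⟩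
  3 * (2 * suc (m + n)) + 2 * (x * y)  ≡⟨ expand x y ⟩
  2 * (m * n) + 24                     ≤⟨ +-monoʳ-≤ (2 * (m * n)) 24≤mn ⟩
  2 * (m * n) + m * n                  ≡⟨ +-comm (2 * (m * n)) (m * n) ⟩
  3 * (m * n)                          ∎)
  where
    open ≤-Reasoning
    expand : ∀ x y → 3 * (2 * suc (3 + x + (3 + y))) + 2 * (x * y) ≡ 2 * ((3 + x) * (3 + y)) + 24
    expand = solve-∀

-- Asymptotics of ℕ-valued sequences

private
  variable
    a b c f g : ℕ → ℕ

Eventually : (ℕ → Set) → Set
Eventually P = ∃[ N ] (∀ n → n ≥ N → P n)

eventually-zipWith : ∀ {P Q R : ℕ → Set} → (∀ {n} → P n → Q n → R n) → Eventually P → Eventually Q → Eventually R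
eventually-zipWith h (M , P≥M) (N , Q≥N) = M ⊔ N , λ n n≥ → h (P≥M n (m⊔n≤o⇒m≤o M N n≥)) (Q≥N n (m⊔n≤o⇒n≤o M N n≥))

eventually-⌊/2⌋ : ∀ {P : ℕ → Set} → Eventually P → Eventually (P ∘ ⌊_/2⌋)
eventually-⌊/2⌋ (N , P≥N) = 2 * N , λ n n≥2N → P≥N ⌊ n /2⌋ (2*m≤n⇒m≤⌊n/2⌋ n≥2N)

BigO-*ˡ : ∀ k → BigO (λ n → k * a n) a
BigO-*ˡ k = k , 0 , λ n _ → ≤-refl

≤⇒BigO : (∀ n → a n ≤ b n) → BigO a b
≤⇒BigO {b = b} a≤b = 1 , 0 , λ n _ → ≤-trans (a≤b n) (≤-reflexive (sym (*-identityˡ (b n))))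

BigO-mono : Eventually (λ n → a n ≤ b n) → BigO b c → BigO a c
BigO-mono a≤b (C , b≤Cc) = C , eventually-zipWith ≤-trans a≤b b≤Cc

BigO-+ : BigO a c → BigO b c → BigO (λ n → a n + b n) c
BigO-+ {c = c} (C , a≤Cc) (D , b≤Dc) = C + D , eventually-zipWith
  (λ {n} a≤ b≤ → ≤-trans (+-mono-≤ a≤ b≤) (≤-reflexive (sym (*-distribʳ-+ (c n) C D)))) a≤Cc b≤Dc

BigO-trans : BigO a b → BigO b c → BigO a c
BigO-trans {c = c} (C , a≤Cb) (D , b≤Dc) = C * D , eventually-zipWith
  (λ {n} a≤ b≤ → ≤-trans a≤ (≤-trans (*-monoʳ-≤ C b≤) (≤-reflexive (sym (*-assoc C D (c n)))))) a≤Cb b≤Dc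

BigO-∘⌊/2⌋ : BigO a b → BigO (a ∘ ⌊_/2⌋) (b ∘ ⌊_/2⌋)
BigO-∘⌊/2⌋ (C , a≤Cb) = C , eventually-⌊/2⌋ a≤Cb

BigO-positive : BigO a b → (∀ n → 1 ≤ a n) → Eventually (λ n → 1 ≤ b n)
BigO-positive {a} {b} (C , a≤Cb) 1≤a = proj₁ a≤Cb , λ n n≥ → positive (proj₂ a≤Cb n n≥) (1≤a n)
  where
    positive : ∀ {n} → a n ≤ C * b n → 1 ≤ a n → 1 ≤ b n
    positive {n} a≤ 1≤ with b n
    ... | zero  = contradiction (≤-trans 1≤ (≤-trans a≤ (≤-reflexive (*-zeroʳ C)))) λ ()
    ... | suc _ = s≤s z≤n

Asym⇒BigO : Asym a b → BigO a b
Asym⇒BigO {a} {b} a∼b = 2 , proj₁ (a∼b 0 1) , λ n n≥ → halve n (proj₂ (a∼b 0 1) n n≥)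
  where
    halve : ∀ n → 2 * ∣ a n - b n ∣ ≤ 1 * a n → a n ≤ 2 * b n
    halve n 2d≤a = +-cancelʳ-≤ (a n) (a n) (2 * b n) (begin
      a n + a n                           ≡⟨ cong (a n +_) (sym (+-identityʳ (a n))) ⟩
      2 * a n                             ≤⟨ *-monoʳ-≤ 2 (m≤n+∣m-n∣ (a n) (b n)) ⟩
      2 * (b n + d)                       ≡⟨ *-distribˡ-+ 2 (b n) d ⟩
      2 * b n + 2 * d                     ≤⟨ +-monoʳ-≤ (2 * b n) 2d≤a ⟩
      2 * b n + 1 * a n                   ≡⟨ cong (2 * b n +_) (*-identityˡ (a n)) ⟩
      2 * b n + a n                       ∎)
      where
        open ≤-Reasoning
        d = ∣ a n - b n ∣

-- In both proofs below suc (C + q * suc C) reduces to suc q * suc C.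
BigO-LittleO-trans : BigO a b → LittleO b c → LittleO a c
BigO-LittleO-trans {a} {b} {c} (C , a≤Cb) b≪c p q = eventually-zipWith (λ {n} → bound n) a≤Cb (b≪c p (C + q * suc C))
  where
    bound : ∀ n → a n ≤ C * b n → suc q * suc C * b n ≤ suc p * c n → suc q * a n ≤ suc p * c n
    bound n a≤ b≤ = begin
      suc q * a n            ≤⟨ *-monoʳ-≤ (suc q) (≤-trans a≤ (m≤n+m (C * b n) (b n))) ⟩
      suc q * (suc C * b n)  ≡⟨ *-assoc (suc q) (suc C) (b n) ⟨
      suc q * suc C * b n    ≤⟨ b≤ ⟩
      suc p * c n            ∎
      where open ≤-Reasoning

LittleO-BigO-trans : LittleO a b → BigO b c → LittleO a c
LittleO-BigO-trans {a} {b} {c} a≪b (C , b≤Cc) p q = eventually-zipWith (λ {n} → bound n) (a≪b 0 (C + q * suc C)) b≤Cc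
  where
    bound : ∀ n → suc q * suc C * a n ≤ 1 * b n → b n ≤ C * c n → suc q * a n ≤ suc p * c n
    bound n a≤ b≤ = ≤-trans (*-cancelˡ-≤ (suc C) (begin
      suc C * (suc q * a n)  ≡⟨ *-assoc (suc C) (suc q) (a n) ⟨
      suc C * suc q * a n    ≡⟨ cong (_* a n) (*-comm (suc C) (suc q)) ⟩
      suc q * suc C * a n    ≤⟨ a≤ ⟩
      1 * b n                ≡⟨ *-identityˡ (b n) ⟩
      b n                    ≤⟨ b≤ ⟩
      C * c n                ≤⟨ m≤n+m (C * c n) (c n) ⟩
      suc C * c n            ∎)) (m≤m+n (c n) (p * c n))
      where open ≤-Reasoning

module _ (f≪f∘suc : LittleO (λ n → f (n ∸ 1)) f) where

  eventually-grows : ∀ k → Eventually (λ m → suc k * f m ≤ f (suc m))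
  eventually-grows k with f≪f∘suc 0 k
  ... | N , f≪ = N , λ m m≥N → ≤-trans (f≪ (suc m) (m≤n⇒m≤1+n m≥N)) (≤-reflexive (*-identityˡ (f (suc m))))

  eventually-grows-beyond : ∀ k → Eventually (λ m → ∀ n → m < n → suc k * f m ≤ f n)
  eventually-grows-beyond k with eventually-zipWith _,_ (eventually-grows k) (eventually-grows 0)
  ... | N , grows = N , λ m m≥N n m<n → beyond m≥N (≤⇒≤′ m<n)
    where
      beyond : ∀ {m n} → m ≥ N → suc m ≤′ n → suc k * f m ≤ f n
      beyond m≥N ≤′-refl = proj₁ (grows _ m≥N)
      beyond {m} m≥N (≤′-step {n} m<n) = begin
        suc k * f m  ≤⟨ beyond m≥N m<n ⟩
        f n          ≡⟨ +-identityʳ (f n) ⟨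
        1 * f n      ≤⟨ proj₂ (grows n (≤-trans m≥N (≤-trans (n≤1+n m) (≤′⇒≤ m<n)))) ⟩
        f (suc n)    ∎
        where open ≤-Reasoning

  LittleO-∘⌊/2⌋ : LittleO (f ∘ ⌊_/2⌋) f
  LittleO-∘⌊/2⌋ p q = suc (2 * N) , bound
    where
      N = proj₁ (eventually-grows-beyond q)

      bound : ∀ n → n ≥ suc (2 * N) → suc q * f ⌊ n /2⌋ ≤ suc p * f n
      bound (suc n) (s≤s n≥2N) = ≤-trans
        (proj₂ (eventually-grows-beyond q) ⌊ suc n /2⌋ (2*m≤n⇒m≤⌊n/2⌋ (m≤n⇒m≤1+n n≥2N)) (suc n) (⌊n/2⌋<n n))
        (m≤m+n (f (suc n)) (p * f (suc n)))

partialSum : (ℕ → ℕ) → ℕ → ℕ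
partialSum g zero    = 0
partialSum g (suc n) = partialSum g n + g n

-- Once f doubles at every step, Σ_{N ≤ m < h} f m ≤ f h; the initial segment is absorbed using f ≥ 1.
partialSum-BigO : Eventually (λ n → 1 ≤ f n) → Eventually (λ n → 2 * f n ≤ f (suc n)) →
                  BigO g f → BigO (partialSum g) f
partialSum-BigO {f} {g} 1≤f doubling (C , g≤Cf) =
  bound (eventually-zipWith _,_ 1≤f (eventually-zipWith _,_ doubling g≤Cf))
  where
    bound : Eventually (λ n → 1 ≤ f n × 2 * f n ≤ f (suc n) × g n ≤ C * f n) → BigO (partialSum g) f
    bound (N , hyp) = K + C , N , λ h h≥N → begin
      partialSum g h      ≤⟨ tail (≤⇒≤′ h≥N) ⟩
      K + C * f h         ≡⟨ cong (_+ C * f h) (*-identityʳ K) ⟨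
      K * 1 + C * f h     ≤⟨ +-monoˡ-≤ (C * f h) (*-monoʳ-≤ K (proj₁ (hyp h h≥N))) ⟩
      K * f h + C * f h   ≡⟨ *-distribʳ-+ (f h) K C ⟨
      (K + C) * f h       ∎
      where
        open ≤-Reasoning
        K = partialSum g N

        tail : ∀ {h} → N ≤′ h → partialSum g h ≤ K + C * f h
        tail ≤′-refl = m≤m+n K (C * f N)
        tail (≤′-step {h} N≤h) = let _ , doubles , g≤ = hyp h (≤′⇒≤ N≤h) in begin
          partialSum g h + g h     ≤⟨ +-mono-≤ (tail N≤h) g≤ ⟩
          K + C * f h + C * f h    ≡⟨ +-assoc K (C * f h) (C * f h) ⟩
          K + (C * f h + C * f h)  ≡⟨ cong (K +_) (double C (f h)) ⟩
          K + C * (2 * f h)        ≤⟨ +-monoʳ-≤ K (*-monoʳ-≤ C doubles) ⟩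
          K + C * f (suc h)        ∎
          where
            double : ∀ x y → x * y + x * y ≡ x * (2 * y)
            double = solve-∀

-- Additive primes in an arithmetical semiring

module _ (𝕊 : ArithmeticalSemiring) where
  open ArithmeticalSemiring 𝕊
  open Counting 𝕊

  ∂e□≡1 : ∂ e□ ≡ 1
  ∂e□≡1 with ∂ e□ in eq
  ... | zero  = contradiction (∂-zero e□ eq) e□-ne
  ... | suc k = *-cancelˡ-≡ (suc k) 1 (suc k) (begin
    suc k * suc k   ≡⟨ sym (cong₂ _*_ eq eq) ⟩
    ∂ e□ * ∂ e□     ≡⟨ sym (∂-□ e□ e□) ⟩
    ∂ (e□ □ e□)     ≡⟨ cong ∂ (□-identity e□ e□-ne) ⟩
    ∂ e□            ≡⟨ eq ⟩
    suc k           ≡⟨ *-identityʳ (suc k) ⟨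
    suc k * 1       ∎)
    where open ≡-Reasoning

  addPrime⇒1≤∂ : ∀ {a} → AddPrime a → 1 ≤ ∂ a
  addPrime⇒1≤∂ {a} ap with ∂ a in eq
  ... | zero  = contradiction (∂-zero a eq) (addPrime-ne a ap)
  ... | suc _ = s≤s z≤n

  mulPrime⇒2≤∂ : ∀ {p} → MulPrime p → 2 ≤ ∂ p
  mulPrime⇒2≤∂ {p} mp with ∂ p in eq
  ... | zero        = contradiction (∂-zero p eq) (addPrime-ne p (mulPrime-add p mp))
  ... | suc zero    = contradiction (deg1 p (mulPrime-add p mp) eq) (mulPrime-ne p mp)
  ... | suc (suc _) = s≤s (s≤s z≤n)

  ∂≤∂-□ : ∀ a {b} → AddPrime b → ∂ a ≤ ∂ (a □ b)
  ∂≤∂-□ a {b} ab = begin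
    ∂ a          ≡⟨ *-identityʳ (∂ a) ⟨
    ∂ a * 1      ≤⟨ *-monoʳ-≤ (∂ a) (addPrime⇒1≤∂ ab) ⟩
    ∂ a * ∂ b    ≡⟨ ∂-□ a b ⟨
    ∂ (a □ b)    ∎
    where open ≤-Reasoning

  □-identityʳ : ∀ {a} → AddPrime a → a □ e□ ≡ a
  □-identityʳ {a} ap = ≡-trans (□-comm a e□) (□-identity a (addPrime-ne a ap))

  □-left-comm : ∀ a b c → a □ (b □ c) ≡ b □ (a □ c)
  □-left-comm a b c = begin
    a □ (b □ c)  ≡⟨ □-assoc a b c ⟨
    (a □ b) □ c  ≡⟨ cong (_□ c) (□-comm a b) ⟩
    (b □ a) □ c  ≡⟨ □-assoc b a c ⟩
    b □ (a □ c)  ∎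
    where open ≡-Reasoning

  prod : List S → S
  prod = foldr _□_ e□

  prod-addPrime : ∀ {xs} → All MulPrime xs → AddPrime (prod xs)
  prod-addPrime []                  = e□-addPrime
  prod-addPrime {x ∷ xs} (px ∷ pxs) = addPrime-□ x (prod xs) (mulPrime-add x px) (prod-addPrime pxs)

  prod-↭ : ∀ {xs ys} → xs ↭ ys → prod xs ≡ prod ys
  prod-↭ refl         = refl
  prod-↭ (prep x p)   = cong (x □_) (prod-↭ p)
  prod-↭ (swap x y p) = ≡-trans (cong (λ z → x □ (y □ z)) (prod-↭ p)) (□-left-comm x y _)
  prod-↭ (trans p q)  = ≡-trans (prod-↭ p) (prod-↭ q)

  HasDegreeTwoFactor : S → Set
  HasDegreeTwoFactor a = ∃₂ λ r b → AddPrime r × AddPrime b × ∂ r ≡ 2 × a ≡ r □ b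

  data Shape (a : S) : Set where
    prime         : MulPrime a → Shape a
    degree-two    : HasDegreeTwoFactor a → Shape a
    large-factors : ∀ p b → AddPrime p → AddPrime b → 3 ≤ ∂ p → 3 ≤ ∂ b → a ≡ p □ b → Shape a

  degreeTwoFactor⊎large : ∀ {xs} → All MulPrime xs → HasDegreeTwoFactor (prod xs) ⊎ All (λ x → 3 ≤ ∂ x) xs
  degreeTwoFactor⊎large [] = inj₂ []
  degreeTwoFactor⊎large {x ∷ xs} (px ∷ pxs) with ∂ x ≟ 2 | degreeTwoFactor⊎large pxs
  ... | yes ∂x≡2 | _ = inj₁ (x , prod xs , mulPrime-add x px , prod-addPrime pxs , ∂x≡2 , refl)
  ... | no _ | inj₁ (r , b , ar , ab , ∂r≡2 , eq) =
    inj₁ (r , x □ b , ar , addPrime-□ x b (mulPrime-add x px) ab , ∂r≡2 , ≡-trans (cong (x □_) eq) (□-left-comm x r b))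
  ... | no ∂x≢2 | inj₂ large = inj₂ (≤∧≢⇒< (mulPrime⇒2≤∂ px) (≢-sym ∂x≢2) ∷ large)

  shape : ∀ {a} → AddPrime a → 2 ≤ ∂ a → Shape a
  shape {a} ap 2≤∂a with proj₁ □-free a ap
  ... | [] , _ , refl = contradiction (≤-trans 2≤∂a (≤-reflexive ∂e□≡1)) (1+n≰n {1})
  ... | p ∷ [] , mp ∷ [] , refl = prime (subst MulPrime (sym (□-identityʳ (mulPrime-add p mp))) mp)
  ... | p ∷ q ∷ qs , mps@(mp ∷ mqs) , refl with degreeTwoFactor⊎large mps
  ...   | inj₁ two = degree-two two
  ...   | inj₂ (3≤∂p ∷ 3≤∂q ∷ _) = large-factors p (prod (q ∷ qs)) (mulPrime-add p mp) (prod-addPrime mqs) 3≤∂p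
            (≤-trans 3≤∂q (∂≤∂-□ q (prod-addPrime (All.tail mqs)))) refl

  collapse : S → S
  collapse s = prod (proj₁ (proj₁ ⊕-free s tt))

  collapse-⊕ : ∀ {p b} → AddPrime p → AddPrime b → collapse (p ⊕ b) ≡ p □ b
  collapse-⊕ {p} {b} ap ab with proj₁ ⊕-free (p ⊕ b) tt
  ... | summands , primes , sum≡ = ≡-trans (prod-↭ summands↭pb) (cong (p □_) (□-identityʳ ab))
    where
      summands↭pb : summands ↭ p ∷ b ∷ []
      summands↭pb = proj₂ ⊕-free summands (p ∷ b ∷ []) primes (ap ∷ ab ∷ [])
        (≡-trans sum≡ (cong (p ⊕_) (sym (≡-trans (⊕-comm b e₊) (⊕-identity b)))))

  fibresBelow : ℕ → List S
  fibresBelow zero    = []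
  fibresBelow (suc h) = fibresBelow h ++ fibre h

  length-fibresBelow : ∀ h → length (fibresBelow h) ≡ partialSum Sₙ h
  length-fibresBelow zero    = refl
  length-fibresBelow (suc h) = ≡-trans (length-++ (fibresBelow h)) (cong (_+ Sₙ h) (length-fibresBelow h))

  ∈-fibresBelow : ∀ {s h} → ∂ s < h → s ∈ fibresBelow h
  ∈-fibresBelow {s} {suc h} ∂s<1+h with m≤n⇒m<n∨m≡n (s≤s⁻¹ ∂s<1+h)
  ... | inj₁ ∂s<h = ∈-++⁺ˡ (∈-fibresBelow ∂s<h)
  ... | inj₂ ∂s≡h = ∈-++⁺ʳ (fibresBelow h) (Enumerates.complete (fibre-enum h) s ∂s≡h)

  candidates : ℕ → List S
  candidates n = fibre□ n ++ cartesianProductWith _□_ (fibre⁺ 2) (fibre⁺ ⌊ n /2⌋) ++ map collapse (fibresBelow ⌊ n /2⌋)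

  length-candidates : ∀ n → length (candidates n) ≡ S□ₙ n + (S⁺ₙ 2 * S⁺ₙ ⌊ n /2⌋ + partialSum Sₙ ⌊ n /2⌋)
  length-candidates n = begin
    length (fibre□ n ++ pairs ++ collapsed)    ≡⟨ length-++ (fibre□ n) ⟩
    S□ₙ n + length (pairs ++ collapsed)        ≡⟨ cong (S□ₙ n +_) (length-++ pairs) ⟩
    S□ₙ n + (length pairs + length collapsed)  ≡⟨ cong (S□ₙ n +_) (cong₂ _+_ length-pairs length-collapsed) ⟩
    S□ₙ n + (S⁺ₙ 2 * S⁺ₙ h + partialSum Sₙ h)  ∎
    where
      open ≡-Reasoning
      h = ⌊ n /2⌋
      pairs = cartesianProductWith _□_ (fibre⁺ 2) (fibre⁺ h)
      collapsed = map collapse (fibresBelow h)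

      length-pairs : length pairs ≡ S⁺ₙ 2 * S⁺ₙ h
      length-pairs = length-cartesianProductWith _□_ (fibre⁺ 2) (fibre⁺ h)

      length-collapsed : length collapsed ≡ partialSum Sₙ h
      length-collapsed = ≡-trans (length-map collapse (fibresBelow h)) (length-fibresBelow h)

  fibre⁺⊆candidates : ∀ {n} → 24 ≤ n → fibre⁺ n ⊆ candidates n
  fibre⁺⊆candidates {n} 24≤n {a} a∈ with All.lookup (Enumerates.sound (fibre⁺-enum n)) a∈
  ... | ap , refl with shape ap (≤-trans (s≤s (s≤s z≤n)) 24≤n)
  ... | prime mp = ∈-++⁺ˡ (Enumerates.complete (fibre□-enum _) a (mp , refl))
  ... | degree-two (r , b , ar , ab , ∂r≡2 , refl) =
    ∈-++⁺ʳ (fibre□ _) (∈-++⁺ˡ (∈-cartesianProductWith⁺ _□_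
      (Enumerates.complete (fibre⁺-enum 2) r (ar , ∂r≡2))
      (Enumerates.complete (fibre⁺-enum _) b (ab , ∂b≡⌊∂a/2⌋))))
    where
      ∂b≡⌊∂a/2⌋ : ∂ b ≡ ⌊ ∂ (r □ b) /2⌋
      ∂b≡⌊∂a/2⌋ = sym (≡-trans (cong ⌊_/2⌋ (≡-trans (∂-□ r b) (cong (_* ∂ b) ∂r≡2))) (⌊2*n/2⌋≡n (∂ b)))
  ... | large-factors p b ap′ ab 3≤∂p 3≤∂b refl =
    ∈-++⁺ʳ (fibre□ _) (∈-++⁺ʳ (cartesianProductWith _□_ (fibre⁺ 2) (fibre⁺ h))
      (subst (_∈ map collapse (fibresBelow h)) (collapse-⊕ ap′ ab) (∈-map⁺ collapse (∈-fibresBelow ∂[p⊕b]<⌊∂a/2⌋))))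
    where
      h = ⌊ ∂ (p □ b) /2⌋

      ∂[p⊕b]<⌊∂a/2⌋ : ∂ (p ⊕ b) < ⌊ ∂ (p □ b) /2⌋
      ∂[p⊕b]<⌊∂a/2⌋ = subst₂ (λ m n → m < ⌊ n /2⌋) (sym (∂-⊕ p b)) (sym (∂-□ p b))
        (2*m≤n⇒m≤⌊n/2⌋ (2*[1+m+n]≤m*n 3≤∂p 3≤∂b (subst (24 ≤_) (∂-□ p b) 24≤n)))

  S□ₙ≤S⁺ₙ : ∀ n → S□ₙ n ≤ S⁺ₙ n
  S□ₙ≤S⁺ₙ n = Unique-⊆⇒length≤ (Enumerates.unique (fibre□-enum n)) λ {x} x∈ →
    let mp , ∂x≡n = All.lookup (Enumerates.sound (fibre□-enum n)) x∈
    in Enumerates.complete (fibre⁺-enum n) x (mulPrime-add x mp , ∂x≡n)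

  S⁺ₙ≤S□ₙ+ : ∀ {n} → 24 ≤ n → S⁺ₙ n ≤ S□ₙ n + (S⁺ₙ 2 * S⁺ₙ ⌊ n /2⌋ + partialSum Sₙ ⌊ n /2⌋)
  S⁺ₙ≤S□ₙ+ {n} 24≤n = ≤-trans
    (Unique-⊆⇒length≤ (Enumerates.unique (fibre⁺-enum n)) (fibre⁺⊆candidates 24≤n))
    (≤-reflexive (length-candidates n))

  ∣S⁺ₙ-S□ₙ∣≤ : ∀ {n} → 24 ≤ n → ∣ S⁺ₙ n - S□ₙ n ∣ ≤ S⁺ₙ 2 * S⁺ₙ ⌊ n /2⌋ + partialSum Sₙ ⌊ n /2⌋
  ∣S⁺ₙ-S□ₙ∣≤ {n} 24≤n = begin
    ∣ S⁺ₙ n - S□ₙ n ∣  ≡⟨ m≤n⇒∣n-m∣≡n∸m (S□ₙ≤S⁺ₙ n) ⟩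
    S⁺ₙ n ∸ S□ₙ n      ≤⟨ m≤n+o⇒m∸n≤o (S⁺ₙ n) (S□ₙ n) (S⁺ₙ≤S□ₙ+ 24≤n) ⟩
    S⁺ₙ 2 * S⁺ₙ ⌊ n /2⌋ + partialSum Sₙ ⌊ n /2⌋ ∎
    where open ≤-Reasoning

  ones : ℕ → S
  ones zero    = e₊
  ones (suc n) = e□ ⊕ ones n

  ∂-ones : ∀ n → ∂ (ones n) ≡ n
  ∂-ones zero    = ∂-e₊
  ∂-ones (suc n) = ≡-trans (∂-⊕ e□ (ones n)) (cong₂ _+_ ∂e□≡1 (∂-ones n))

  1≤Sₙ : ∀ n → 1 ≤ Sₙ n
  1≤Sₙ n = ∈-length (Enumerates.complete (fibre-enum n) (ones n) (∂-ones n))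

  ∣S⁺ₙ-S□ₙ∣-BigO : G₁⁺ → G₂⁺ → BigO (λ n → ∣ S⁺ₙ n - S□ₙ n ∣) (S⁺ₙ ∘ ⌊_/2⌋)
  ∣S⁺ₙ-S□ₙ∣-BigO g₁⁺ g₂⁺ =
    BigO-mono (24 , λ _ → ∣S⁺ₙ-S□ₙ∣≤) (BigO-+ (BigO-*ˡ (S⁺ₙ 2)) (BigO-∘⌊/2⌋ partialSumSₙ-BigO))
    where
      Sₙ-BigO : BigO Sₙ S⁺ₙ
      Sₙ-BigO = Asym⇒BigO g₁⁺

      partialSumSₙ-BigO : BigO (partialSum Sₙ) S⁺ₙ
      partialSumSₙ-BigO = partialSum-BigO (BigO-positive Sₙ-BigO 1≤Sₙ) (eventually-grows g₂⁺ 1) Sₙ-BigO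

corollary3p16 : (𝕊 : ArithmeticalSemiring) → let open Counting 𝕊 in
    G₁⁺ → G₂⁺ → G₁□ × G₂□ × G₃□
corollary3p16 𝕊 g₁⁺ g₂⁺ = g₁□ , g₂□ , g₂□ , BigO-trans defect-BigO (BigO-∘⌊/2⌋ (Asym⇒BigO g₁□))
  where
    open Counting 𝕊

    S⁺ₙ∘⌊/2⌋-LittleO : LittleO (S⁺ₙ ∘ ⌊_/2⌋) S⁺ₙ
    S⁺ₙ∘⌊/2⌋-LittleO = LittleO-∘⌊/2⌋ g₂⁺

    defect-BigO : BigO (λ n → ∣ S⁺ₙ n - S□ₙ n ∣) (S⁺ₙ ∘ ⌊_/2⌋)
    defect-BigO = ∣S⁺ₙ-S□ₙ∣-BigO 𝕊 g₁⁺ g₂⁺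

    g₁□ : G₁□
    g₁□ = BigO-LittleO-trans defect-BigO S⁺ₙ∘⌊/2⌋-LittleO

    g₂□ : G₂□
    g₂□ = BigO-LittleO-trans (≤⇒BigO (S□ₙ≤S⁺ₙ 𝕊 ∘ ⌊_/2⌋))
            (LittleO-BigO-trans S⁺ₙ∘⌊/2⌋-LittleO (Asym⇒BigO g₁□))
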